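{- Let $n,d$ be natural numbers with $n\ge 3$ and $1\le d\le \sigma^\boxtimes_V(C_n)=\sigma^\times_V(C_n)$, where $C_n$ is the cycle on $n$ vertices. Then $\mathrm{cap}^\boxtimes_d(C_n)=\mathrm{cap}^\times_d(C_n)=\left\lfloor \frac{n}{d}\right\rfloor$.
   Context: $d_G$ denotes shortest-path distance. For an integer $\ell\ge 0$, a walk (resp. weak walk) of length $\ell$ on a graph $G$ is a function $f:\{0,\dots,\ell\}\to V(G)$ with $f(i)f(i+1)\in E(G)$ (resp. $f(i)=f(i+1)$ or $f(i)f(i+1)\in E(G)$) for all $0\le i<\ell$; an $\ell$-track (resp. weak $\ell$-track) is a surjective one. For $f,g:\{0,\dots,\ell\}\to V(G)$, $m_G(f,g)=\min_i d_G(f(i),g(i))$; for a family $F=\{f_1,\dots,f_p\}$ with $p\ge2$, $m_G(F)=\min_{i\ne j}m_G(f_i,f_j)$, and $m_G(F)=\infty$ if $p=1$. An $\ell$-tour (resp. weak $\ell$-tour) is a family of $\ell$-tracks (resp. weak $\ell$-tracks). $\sigma^\times_V(G)=\max\{m_G(f,g):\ell\ge0,\ f,g\ \ell\text{ -tracks}\}$ and $\sigma^\boxtimes_V(G)$ is the same over weak $\ell$-tracks (it is known that both equal $\lfloor n/2\rfloor$ for $C_n$). For natural $d\le\sigma^\times_V(G)$, $\mathrm{cap}^\times_d(G)$ is the maximum $c$ such that there is an $\ell$-tour $F=\{f_1,\dots,f_c\}$ with $m_G(F)=d$; for natural $d\le\sigma^\boxtimes_V(G)$, $\mathrm{cap}^\boxtimes_d(G)$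 is the maximum $c$ such that there is a weak $\ell$-tour $F=\{f_1,\dots,f_c\}$ with $m_G(F)=d$. -}

module Defs where

open import Data.Nat using (ℕ; zero; suc; _+_; _≤_; _<_; _%_; NonZero)
open import Data.Fin using (Fin; toℕ; inject₁; fromℕ) renaming (zero to fzero; suc to fsuc)
open import Data.Product using (Σ; ∃; ∃-syntax; _×_; _,_)
open import Data.Sum using (_⊎_)
open import Relation.Binary.PropositionalEquality using (_≡_; _≢_)
open import Relation.Nullary using (¬_)

record Graph : Set₁ where
  field
    V : Set
    E : V → V → Set

open Graph public

-- The cycle C_n on vertices 0,…,n-1 : i ~ j iff j ≡ i+1 (mod n) or i ≡ j+1 (mod n).
-- (For n ≥ 3 this is the simple n-cycle.)
Cycle : (n : ℕ) → .{{NonZero n}} → Graph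
Cycle n = record
  { V = Fin n
  ; E = λ u v → (toℕ v ≡ (toℕ u + 1) % n) ⊎ (toℕ u ≡ (toℕ v + 1) % n) }

IsWalk : (G : Graph) (ℓ : ℕ) → (Fin (suc ℓ) → V G) → Set
IsWalk G ℓ f = (i : Fin ℓ) → E G (f (inject₁ i)) (f (fsuc i))

IsWeakWalk : (G : Graph) (ℓ : ℕ) → (Fin (suc ℓ) → V G) → Set
IsWeakWalk G ℓ f = (i : Fin ℓ) → (f (inject₁ i) ≡ f (fsuc i)) ⊎ E G (f (inject₁ i)) (f (fsuc i))

Surjective : {A B : Set} → (A → B) → Set
Surjective {A} {B} f = (b : B) → ∃[ a ] f a ≡ b

IsTrack : (G : Graph) (ℓ : ℕ) → (Fin (suc ℓ) → V G) → Set
IsTrack G ℓ f = IsWalk G ℓ f × Surjective f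

IsWeakTrack : (G : Graph) (ℓ : ℕ) → (Fin (suc ℓ) → V G) → Set
IsWeakTrack G ℓ f = IsWeakWalk G ℓ f × Surjective f

WalkOfLen : (G : Graph) → ℕ → V G → V G → Set
WalkOfLen G k u v =
  ∃[ g ] IsWalk G k g × g fzero ≡ u × g (fromℕ k) ≡ v

DistGE : (G : Graph) → V G → V G → ℕ → Set
DistGE G u v k = ∀ j → j < k → ¬ WalkOfLen G j u v

DistEq : (G : Graph) → V G → V G → ℕ → Set
DistEq G u v k = WalkOfLen G k u v × DistGE G u v k

-- m_G(F) = d for a family F = {f_1,…,f_c} of functions {0,…,ℓ} → V(G)
-- (min over pairs i ≠ j and times t of d_G(f_i(t), f_j(t)) equals d;
--  in particular this forces c ≥ 2, since m_G(F) = ∞ when c = 1).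
MinSepEq : (G : Graph) {c ℓ : ℕ} → (Fin c → Fin (suc ℓ) → V G) → ℕ → Set
MinSepEq G {c} {ℓ} F d =
  ((i j : Fin c) → i ≢ j → (t : Fin (suc ℓ)) → DistGE G (F i t) (F j t) d)
  × (∃[ i ] ∃[ j ] ∃[ t ] (i ≢ j × DistEq G (F i t) (F j t) d))

HasTour : (G : Graph) → (d c : ℕ) → Set
HasTour G d c = ∃[ ℓ ] ∃[ F ] (((i : Fin c) → IsTrack G ℓ (F i)) × MinSepEq G {c} {ℓ} F d)

HasWeakTour : (G : Graph) → (d c : ℕ) → Set
HasWeakTour G d c = ∃[ ℓ ] ∃[ F ] (((i : Fin c) → IsWeakTrack G ℓ (F i)) × MinSepEq G {c} {ℓ} F d)

IsMaximum : (ℕ → Set) → ℕ → Set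
IsMaximum P m = P m × ((c : ℕ) → P c → c ≤ m)

CapEq : (G : Graph) → (d m : ℕ) → Set
CapEq G d m = IsMaximum (HasTour G d) m

WeakCapEq : (G : Graph) → (d m : ℕ) → Set
WeakCapEq G d m = IsMaximum (HasWeakTour G d) m

-- Measure positions on C_n by clockwise offsets. Two points at distance ≥ d own disjoint
-- clockwise arcs of d consecutive vertices, so c tracks that are pairwise d apart at time 0
-- give c·d distinct vertices and c ≤ ⌊n/d⌋. Conversely the c = ⌊n/d⌋ tracks
-- t ↦ i·d + t (mod n), i < c, all sweep clockwise around the cycle in lockstep, so their
-- mutual offsets never change; a walk of length e changes a clockwise offset by at most e,
-- hence tracks i and j stay at distance ≥ d, and tracks 0 and 1 are at distance exactly d.
-- Every tour is a weak tour, so these two bounds settle both capacities.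
module Submission where

open import Defs
open import Data.Nat using (ℕ; zero; suc; _+_; _*_; _∸_; _≤_; _<_; _%_; _/_; NonZero; z≤n; s≤s; s≤s⁻¹; >-nonZero)
open import Data.Nat.Properties
open import Data.Nat.DivMod
open import Data.Fin using (Fin; toℕ; fromℕ; fromℕ<; inject₁; combine; remQuot) renaming (zero to fzero; suc to fsuc)
open import Data.Fin.Properties using (toℕ<n; toℕ-fromℕ<; toℕ-fromℕ; toℕ-inject₁; toℕ-injective; injective⇒≤; combine-remQuot) renaming (_≟_ to _≟ᶠ_)
open import Data.Product using (∃-syntax; _×_; _,_; proj₁; proj₂; uncurry)
open import Data.Sum using (_⊎_; inj₁; inj₂)
open import Data.Empty using (⊥-elim)
open import Function using (_∘_)
open import Relation.Nullary using (yes; no)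
open import Relation.Binary.PropositionalEquality
open import Algebra.Properties.CommutativeSemigroup +-commutativeSemigroup using (x∙yz≈y∙xz; xy∙z≈xz∙y)
open ≡-Reasoning

[m%n+o]%n≡[m+o]%n : ∀ m o n .{{_ : NonZero n}} → (m % n + o) % n ≡ (m + o) % n
[m%n+o]%n≡[m+o]%n m o n = begin
  (m % n + o) % n         ≡⟨ %-distribˡ-+ (m % n) o n ⟩
  (m % n % n + o % n) % n ≡⟨ cong (λ x → (x + o % n) % n) (m%n%n≡m%n m n) ⟩
  (m % n + o % n) % n     ≡⟨ %-distribˡ-+ m o n ⟨
  (m + o) % n             ∎

[m+o%n]%n≡[m+o]%n : ∀ m o n .{{_ : NonZero n}} → (m + o % n) % n ≡ (m + o) % n
[m+o%n]%n≡[m+o]%n m o n = begin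
  (m + o % n) % n ≡⟨ cong (_% n) (+-comm m (o % n)) ⟩
  (o % n + m) % n ≡⟨ [m%n+o]%n≡[m+o]%n o m n ⟩
  (o + m) % n     ≡⟨ cong (_% n) (+-comm o m) ⟩
  (m + o) % n     ∎

-- Adding o is undone by adding o·(n - 1), a multiple of n in total.
%-cancelʳ-+ : ∀ o m k n .{{_ : NonZero n}} → (m + o) % n ≡ (k + o) % n → m % n ≡ k % n
%-cancelʳ-+ o m k n eq = begin
  m % n                            ≡⟨ undo m ⟩
  ((m + o) % n + o * (n ∸ 1)) % n  ≡⟨ cong (λ x → (x + o * (n ∸ 1)) % n) eq ⟩
  ((k + o) % n + o * (n ∸ 1)) % n  ≡⟨ undo k ⟨
  k % n                            ∎
  where
  undo : ∀ x → x % n ≡ ((x + o) % n + o * (n ∸ 1)) % n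
  undo x = begin
    x % n                           ≡⟨ [m+kn]%n≡m%n x o n ⟨
    (x + o * n) % n                 ≡⟨ cong (λ y → (x + o * y) % n) (suc-pred n) ⟨
    (x + o * suc (n ∸ 1)) % n       ≡⟨ cong (λ y → (x + y) % n) (*-suc o (n ∸ 1)) ⟩
    (x + (o + o * (n ∸ 1))) % n     ≡⟨ cong (_% n) (+-assoc x o (o * (n ∸ 1))) ⟨
    (x + o + o * (n ∸ 1)) % n       ≡⟨ [m%n+o]%n≡[m+o]%n (x + o) (o * (n ∸ 1)) n ⟨
    ((x + o) % n + o * (n ∸ 1)) % n ∎

m*o≡n*o+k⇒m≡n : ∀ {m n k} o .{{_ : NonZero o}} → m * o ≡ n * o + k → k < o → m ≡ n
m*o≡n*o+k⇒m≡n {m} {n} {k} o eq k<o = ≤-antisym (s≤s⁻¹ m<1+n) n≤m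
  where
  n≤m : n ≤ m
  n≤m = *-cancelʳ-≤ n m o (subst (n * o ≤_) (sym eq) (m≤m+n (n * o) k))
  m<1+n : m < suc n
  m<1+n = *-cancelʳ-< o m (suc n) (subst (_< suc n * o) (sym eq)
    (<-≤-trans (+-monoʳ-< (n * o) k<o) (≤-reflexive (+-comm (n * o) o))))

m*o≤n⇒m≤n/o : ∀ {m n} o .{{_ : NonZero o}} → m * o ≤ n → m ≤ n / o
m*o≤n⇒m≤n/o {m} {n} o le = subst (_≤ n / o) (m*n/n≡m m o) (/-monoˡ-≤ o le)

remQuot-injective : ∀ {c} d {x y : Fin (c * d)} → remQuot {c} d x ≡ remQuot d y → x ≡ y
remQuot-injective {c} d {x} {y} eq = begin
  x                                 ≡⟨ combine-remQuot {c} d x ⟨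
  uncurry combine (remQuot {c} d x) ≡⟨ cong (uncurry combine) eq ⟩
  uncurry combine (remQuot {c} d y) ≡⟨ combine-remQuot {c} d y ⟩
  y                                 ∎

HasTour⇒HasWeakTour : ∀ {G d c} → HasTour G d c → HasWeakTour G d c
HasTour⇒HasWeakTour (ℓ , F , tracks , sep) =
  ℓ , F , (λ i → inj₂ ∘ proj₁ (tracks i) , proj₂ (tracks i)) , sep

module _ {n : ℕ} .{{_ : NonZero n}} where

  toℕ%n≡toℕ : (u : Fin n) → toℕ u % n ≡ toℕ u
  toℕ%n≡toℕ u = m<n⇒m%n≡m (toℕ<n u)

  [toℕ+0]%n≡toℕ : (u : Fin n) → (toℕ u + 0) % n ≡ toℕ u
  [toℕ+0]%n≡toℕ u = trans (cong (_% n) (+-identityʳ (toℕ u))) (toℕ%n≡toℕ u)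

  -- The edges of Cycle n are exactly Clockwise u v 1 ⊎ Clockwise v u 1.
  record Clockwise (u v : Fin n) (k : ℕ) : Set where
    constructor clockwise
    field offset : toℕ v ≡ (toℕ u + k) % n

  Clockwise-mod : ∀ a k → Clockwise (a mod n) ((a + k) mod n) k
  Clockwise-mod a k = clockwise (begin
    toℕ ((a + k) mod n)      ≡⟨ toℕ-fromℕ< _ ⟩
    (a + k) % n              ≡⟨ [m%n+o]%n≡[m+o]%n a k n ⟨
    (a % n + k) % n          ≡⟨ cong (λ x → (x + k) % n) (toℕ-fromℕ< _) ⟨
    (toℕ (a mod n) + k) % n  ∎)

  Clockwise-functional : ∀ {u v w k} → Clockwise u v k → Clockwise u w k → v ≡ w
  Clockwise-functional (clockwise p) (clockwise q) = toℕ-injective (trans p (sym q))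

  Clockwise-refl : ∀ {u} → Clockwise u u 0
  Clockwise-refl {u} = clockwise (sym ([toℕ+0]%n≡toℕ u))

  Clockwise-0⇒≡ : ∀ {u v} → Clockwise u v 0 → u ≡ v
  Clockwise-0⇒≡ {u} (clockwise p) = toℕ-injective (sym (trans p ([toℕ+0]%n≡toℕ u)))

  Clockwise-trans : ∀ {u v w j k} → Clockwise u v j → Clockwise v w k → Clockwise u w (j + k)
  Clockwise-trans {u} {v} {w} {j} {k} (clockwise p) (clockwise q) = clockwise (begin
    toℕ w                     ≡⟨ q ⟩
    (toℕ v + k) % n           ≡⟨ cong (λ x → (x + k) % n) p ⟩
    ((toℕ u + j) % n + k) % n ≡⟨ [m%n+o]%n≡[m+o]%n (toℕ u + j) k n ⟩
    (toℕ u + j + k) % n       ≡⟨ cong (_% n) (+-assoc (toℕ u) j k) ⟩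
    (toℕ u + (j + k)) % n     ∎)

  Clockwise-cancelˡ : ∀ {u v w j k} → Clockwise u v (j + k) → Clockwise u w j → Clockwise w v k
  Clockwise-cancelˡ {u} {v} {w} {j} {k} (clockwise p) (clockwise q) = clockwise (begin
    toℕ v                     ≡⟨ p ⟩
    (toℕ u + (j + k)) % n     ≡⟨ cong (_% n) (+-assoc (toℕ u) j k) ⟨
    (toℕ u + j + k) % n       ≡⟨ [m%n+o]%n≡[m+o]%n (toℕ u + j) k n ⟨
    ((toℕ u + j) % n + k) % n ≡⟨ cong (λ x → (x + k) % n) q ⟨
    (toℕ w + k) % n           ∎)

  Clockwise-cancelʳ : ∀ {u v w j k} → Clockwise u v (j + k) → Clockwise w v k → Clockwise u w j
  Clockwise-cancelʳ {u} {v} {w} {j} {k} (clockwise p) (clockwise q) = clockwise (begin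
    toℕ w             ≡⟨ toℕ%n≡toℕ w ⟨
    toℕ w % n         ≡⟨ %-cancelʳ-+ k (toℕ w) (toℕ u + j) n w+k≡u+j+k ⟩
    (toℕ u + j) % n   ∎)
    where
    w+k≡u+j+k : (toℕ w + k) % n ≡ (toℕ u + j + k) % n
    w+k≡u+j+k = trans (sym q) (trans p (cong (_% n) (sym (+-assoc (toℕ u) j k))))

  Clockwise-injective : ∀ {u v j k} → Clockwise u v j → Clockwise u v k → j < n → k < n → j ≡ k
  Clockwise-injective {u} {v} {j} {k} (clockwise p) (clockwise q) j<n k<n = begin
    j       ≡⟨ m<n⇒m%n≡m j<n ⟨
    j % n   ≡⟨ %-cancelʳ-+ (toℕ u) j k n j+u≡k+u ⟩
    k % n   ≡⟨ m<n⇒m%n≡m k<n ⟩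
    k       ∎
    where
    j+u≡k+u : (j + toℕ u) % n ≡ (k + toℕ u) % n
    j+u≡k+u = trans (cong (_% n) (+-comm j (toℕ u)))
                (trans (trans (sym p) q) (cong (_% n) (+-comm (toℕ u) k)))

  Clockwise-reachable : ∀ u v → ∃[ k ] k < n × Clockwise u v k
  Clockwise-reachable u v = k , m%n<n _ n , clockwise (sym (begin
    (toℕ u + k) % n                       ≡⟨ [m+o%n]%n≡[m+o]%n (toℕ u) (toℕ v + (n ∸ toℕ u)) n ⟩
    (toℕ u + (toℕ v + (n ∸ toℕ u))) % n   ≡⟨ cong (_% n) (x∙yz≈y∙xz (toℕ u) (toℕ v) (n ∸ toℕ u)) ⟩
    (toℕ v + (toℕ u + (n ∸ toℕ u))) % n   ≡⟨ cong (λ x → (toℕ v + x) % n) (m+[n∸m]≡n (<⇒≤ (toℕ<n u))) ⟩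
    (toℕ v + n) % n                       ≡⟨ [m+n]%n≡m%n (toℕ v) n ⟩
    toℕ v % n                             ≡⟨ toℕ%n≡toℕ v ⟩
    toℕ v                                 ∎))
    where
    k = (toℕ v + (n ∸ toℕ u)) % n

  Clockwise-mod⇒≡ : ∀ {a b k} t → a + k < n → b < n →
                    Clockwise ((a + t) mod n) ((b + t) mod n) k → b ≡ a + k
  Clockwise-mod⇒≡ {a} {b} {k} t a+k<n b<n (clockwise p) = begin
    b                 ≡⟨ m<n⇒m%n≡m b<n ⟨
    b % n             ≡⟨ %-cancelʳ-+ t b (a + k) n b+t≡a+k+t ⟩
    (a + k) % n       ≡⟨ m<n⇒m%n≡m a+k<n ⟩
    a + k             ∎
    where
    b+t≡a+k+t : (b + t) % n ≡ (a + k + t) % n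
    b+t≡a+k+t = begin
      (b + t) % n                       ≡⟨ toℕ-fromℕ< _ ⟨
      toℕ ((b + t) mod n)               ≡⟨ p ⟩
      (toℕ ((a + t) mod n) + k) % n     ≡⟨ cong (λ x → (x + k) % n) (toℕ-fromℕ< _) ⟩
      ((a + t) % n + k) % n             ≡⟨ [m%n+o]%n≡[m+o]%n (a + t) k n ⟩
      (a + t + k) % n                   ≡⟨ cong (_% n) (xy∙z≈xz∙y a t k) ⟩
      (a + k + t) % n                   ∎

  clockwiseWalk : ℕ → (ℓ : ℕ) → Fin (suc ℓ) → Fin n
  clockwiseWalk a ℓ t = (a + toℕ t) mod n

  clockwiseWalk-isWalk : ∀ a ℓ → IsWalk (Cycle n) ℓ (clockwiseWalk a ℓ)
  clockwiseWalk-isWalk a ℓ i = inj₁ (Clockwise.offset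
    (subst₂ (λ x y → Clockwise (x mod n) (y mod n) 1)
      (cong (a +_) (sym (toℕ-inject₁ i)))
      (trans (+-comm (a + toℕ i) 1) (sym (+-suc a (toℕ i))))
      (Clockwise-mod (a + toℕ i) 1)))

  clockwiseWalk-surjective : ∀ a {ℓ} → n ≤ ℓ → Surjective (clockwiseWalk a ℓ)
  clockwiseWalk-surjective a {ℓ} n≤ℓ v with Clockwise-reachable (a mod n) v
  ... | k , k<n , p = fromℕ< k<1+ℓ , Clockwise-functional
        (subst (λ x → Clockwise (a mod n) ((a + x) mod n) k) (sym (toℕ-fromℕ< k<1+ℓ)) (Clockwise-mod a k))
        p
    where
    k<1+ℓ : k < suc ℓ
    k<1+ℓ = <-≤-trans k<n (m≤n⇒m≤1+n n≤ℓ)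

  Clockwise⇒WalkOfLen : ∀ {u v k} → Clockwise u v k → WalkOfLen (Cycle n) k u v
  Clockwise⇒WalkOfLen {u} {v} {k} (clockwise p) =
    clockwiseWalk (toℕ u) k , clockwiseWalk-isWalk (toℕ u) k ,
    toℕ-injective (trans (toℕ-fromℕ< _) ([toℕ+0]%n≡toℕ u)) ,
    toℕ-injective (trans (toℕ-fromℕ< _) (trans (cong (λ x → (toℕ u + x) % n) (toℕ-fromℕ k)) (sym p)))

  -- Near u v k ⇔ d(u, v) ≤ k in C_n.
  Near : Fin n → Fin n → ℕ → Set
  Near u v k = ∃[ j ] j ≤ k × (Clockwise u v j ⊎ Clockwise v u j)

  edge⇒Near : ∀ {v w k} → E (Cycle n) v w → Near v w (suc k)
  edge⇒Near (inj₁ p) = 1 , s≤s z≤n , inj₁ (clockwise p)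
  edge⇒Near (inj₂ p) = 1 , s≤s z≤n , inj₂ (clockwise p)

  Near-step : ∀ {u v w k} → Near u v k → E (Cycle n) v w → Near u w (suc k)
  Near-step (zero , _ , inj₁ p) e with refl ← Clockwise-0⇒≡ p = edge⇒Near e
  Near-step (zero , _ , inj₂ p) e with refl ← Clockwise-0⇒≡ p = edge⇒Near e
  Near-step {u} (j , j≤k , inj₁ p) (inj₁ q) =
    suc j , s≤s j≤k , inj₁ (subst (Clockwise u _) (+-comm j 1) (Clockwise-trans p (clockwise q)))
  Near-step (j , j≤k , inj₂ p) (inj₂ q) = suc j , s≤s j≤k , inj₂ (Clockwise-trans (clockwise q) p)
  Near-step {u} {v} (suc j , j<k , inj₁ p) (inj₂ q) =
    j , m<n⇒m≤1+n j<k , inj₁ (Clockwise-cancelʳ (subst (Clockwise u v) (+-comm 1 j) p) (clockwise q))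
  Near-step (suc j , j<k , inj₂ p) (inj₁ q) =
    j , m<n⇒m≤1+n j<k , inj₂ (Clockwise-cancelˡ p (clockwise q))

  walk⇒Near : ∀ k g → IsWalk (Cycle n) k g → Near (g fzero) (g (fromℕ k)) k
  walk⇒Near zero    g _ = 0 , z≤n , inj₁ Clockwise-refl
  walk⇒Near (suc k) g w = Near-step (walk⇒Near k (g ∘ inject₁) (w ∘ inject₁)) (w (fromℕ k))

  WalkOfLen⇒Near : ∀ {u v k} → WalkOfLen (Cycle n) k u v → Near u v k
  WalkOfLen⇒Near {k = k} (g , w , refl , refl) = walk⇒Near k g w

  separated⇒*≤ : ∀ {c d} (P : Fin c → Fin n) → d ≤ n →
                 (∀ i j → i ≢ j → DistGE (Cycle n) (P i) (P j) d) → c * d ≤ n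
  separated⇒*≤ {c} {d} P d≤n sep =
    injective⇒≤ {f = arc ∘ remQuot {c} d} (remQuot-injective {c} d ∘ arc-injective)
    where
    arc : Fin c × Fin d → Fin n
    arc (i , s) = (toℕ (P i) + toℕ s) mod n

    on-arc : ∀ {x} i s → arc (i , s) ≡ x → Clockwise (P i) x (toℕ s)
    on-arc i s refl = clockwise (toℕ-fromℕ< _)

    arcs-disjoint : ∀ {i i' s s'} → i ≢ i' → toℕ s ≤ toℕ s' → arc (i , s) ≢ arc (i' , s')
    arcs-disjoint {i} {i'} {s} {s'} i≢i' s≤s' eq =
      sep i' i (i≢i' ∘ sym) (toℕ s' ∸ toℕ s) (≤-<-trans (m∸n≤m (toℕ s') (toℕ s)) (toℕ<n s'))
        (Clockwise⇒WalkOfLen (Clockwise-cancelʳ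
          (subst (Clockwise (P i') _) (sym (m∸n+n≡m s≤s')) (on-arc i' s' (sym eq)))
          (on-arc i s refl)))

    arc-injective : ∀ {x y} → arc x ≡ arc y → x ≡ y
    arc-injective {i , s} {i' , s'} eq with i ≟ᶠ i'
    ... | yes refl = cong (i ,_) (toℕ-injective
          (Clockwise-injective (on-arc i s eq) (on-arc i s' refl)
            (<-≤-trans (toℕ<n s) d≤n) (<-≤-trans (toℕ<n s') d≤n)))
    ... | no i≢i' with ≤-total (toℕ s) (toℕ s')
    ...   | inj₁ s≤s' = ⊥-elim (arcs-disjoint i≢i' s≤s' eq)
    ...   | inj₂ s'≤s = ⊥-elim (arcs-disjoint (i≢i' ∘ sym) s'≤s (sym eq))

  HasWeakTour⇒*≤ : ∀ {c d} → d ≤ n → HasWeakTour (Cycle n) d c → c * d ≤ n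
  HasWeakTour⇒*≤ d≤n (_ , F , _ , sep , _) =
    separated⇒*≤ (λ i → F i fzero) d≤n (λ i j i≢j → sep i j i≢j fzero)

  spacedTour : (d : ℕ) {c : ℕ} → Fin c → Fin (suc n) → Fin n
  spacedTour d i = clockwiseWalk (toℕ i * d) n

  spacedTour-close⇒≡ : ∀ {c d k} (i j : Fin c) t → c * d ≤ n → k < d →
                     Clockwise (spacedTour d i t) (spacedTour d j t) k → i ≡ j
  spacedTour-close⇒≡ {c} {d} {k} i j t cd≤n k<d p =
    toℕ-injective (sym (m*o≡n*o+k⇒m≡n d {{>-nonZero (≤-<-trans z≤n k<d)}} jd≡id+k k<d))
    where
    row-end< : ∀ (i : Fin c) → toℕ i * d + k < n
    row-end< i = <-≤-trans (+-monoʳ-< (toℕ i * d) k<d)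
      (≤-trans (≤-reflexive (+-comm (toℕ i * d) d)) (≤-trans (*-monoˡ-≤ d (toℕ<n i)) cd≤n))
    jd≡id+k : toℕ j * d ≡ toℕ i * d + k
    jd≡id+k = Clockwise-mod⇒≡ (toℕ t) (row-end< i) (≤-<-trans (m≤m+n (toℕ j * d) k) (row-end< j)) p

  spacedTour-separated : ∀ {c d} → c * d ≤ n → (i j : Fin c) → i ≢ j → ∀ t →
                         DistGE (Cycle n) (spacedTour d i t) (spacedTour d j t) d
  spacedTour-separated cd≤n i j i≢j t e e<d walk with WalkOfLen⇒Near walk
  ... | k , k≤e , inj₁ p = i≢j (spacedTour-close⇒≡ i j t cd≤n (≤-<-trans k≤e e<d) p)
  ... | k , k≤e , inj₂ p = i≢j (sym (spacedTour-close⇒≡ j i t cd≤n (≤-<-trans k≤e e<d) p))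

  spacedTour-HasTour : ∀ {c d} → 2 ≤ c → c * d ≤ n → HasTour (Cycle n) d c
  spacedTour-HasTour {c} {d} (s≤s (s≤s _)) cd≤n =
    n , spacedTour d ,
    (λ i → clockwiseWalk-isWalk _ n , clockwiseWalk-surjective _ ≤-refl) ,
    spacedTour-separated cd≤n ,
    fzero , fsuc fzero , fzero , (λ ()) ,
    Clockwise⇒WalkOfLen first-gap , spacedTour-separated {c} cd≤n fzero (fsuc fzero) (λ ()) fzero
    where
    first-gap : Clockwise (spacedTour d {c} fzero fzero) (spacedTour d {c} (fsuc fzero) fzero) d
    first-gap = subst (λ x → Clockwise _ (x mod n) d)
      (sym (trans (+-identityʳ (1 * d)) (*-identityˡ d))) (Clockwise-mod 0 d)

proposition3p10 : (n d : ℕ) → .{{_ : NonZero n}} → .{{_ : NonZero d}} →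
    3 ≤ n → d ≤ n / 2 →
    WeakCapEq (Cycle n) d (n / d) × CapEq (Cycle n) d (n / d)
proposition3p10 n d _ d≤n/2 =
  (HasTour⇒HasWeakTour {Cycle n} tour , fits) , (tour , λ c → fits c ∘ HasTour⇒HasWeakTour {Cycle n})
  where
  d*2≤n : d * 2 ≤ n
  d*2≤n = ≤-trans (*-monoˡ-≤ 2 d≤n/2) (m/n*n≤m n 2)
  tour : HasTour (Cycle n) d (n / d)
  tour = spacedTour-HasTour (m*o≤n⇒m≤n/o d (subst (_≤ n) (*-comm d 2) d*2≤n)) (m/n*n≤m n d)
  fits : ∀ c → HasWeakTour (Cycle n) d c → c ≤ n / d
  fits c = m*o≤n⇒m≤n/o {c} d ∘ HasWeakTour⇒*≤ (≤-trans (m≤m*n d 2) d*2≤n)
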